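{- Let $A\in\mathbb{Z}^{m\times d}$ with $\ker_{\mathbb{Z}}(A)\cap\mathbb{N}^d=\{0\}$ and let $b,b'\in\mathbb{N}A$ with $2|\mathcal{F}_{A,b}|\le|\mathcal{F}_{A,b'+b}|$. Then for any finite set $\mathcal{M}\subset\ker_{\mathbb{Z}}(A)$ and all $u\in\mathcal{F}_{A,b'}$, $$h(\mathcal{F}_{A,b'+b}(\mathcal{M}))\le\frac{2|\mathcal{M}|\cdot|\partial^{\mathcal{M}}_u(\mathcal{F}_{A,b})|}{|\mathcal{F}_{A,b}|}.$$
   Context: $\mathbb{N}A$ is the affine semigroup generated by the columns of $A$; $\mathcal{F}_{A,b}=\{u\in\mathbb{N}^d:Au=b\}$. For finite $\mathcal{F},\mathcal{M}\subset\mathbb{Z}^d$, the fiber graph $\mathcal{F}(\mathcal{M})$ is the graph on $\mathcal{F}$ in which $u,v$ are adjacent if $u-v\in\pm\mathcal{M}$, and every node $w$ gets a loop for every $m\in\pm\mathcal{M}$ with $w+m\notin\mathcal{F}$. For a graph $G=(V,E)$ and $S\subseteq V$, $E_G(S)$ is the set of edges with one endpoint in $S$ and the other in $V\setminus S$; the edge-expansion is $h(G)=\min\{|E_G(S)|/|S|: S\subset V, 0<2|S|\le|V|\}$. For $u\in\mathbb{N}^d$, the $u$-boundary is $\partial^{\mathcal{M}}_u(\mathcal{F}_{A,b})=\{v\in u+\mathcal{F}_{A,b}: \exists m\in\pm\mathcal{M},\ v+m\in\mathbb{N}^d\setminus(u+\mathcal{F}_{A,b})\}$. -}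

module Defs where

open import Data.Nat using (ℕ; zero; suc; _*_; _≤_; _<_)
open import Data.Nat.Properties using (_≤?_; _<?_)
open import Data.Integer as ℤ using (ℤ; +_; 0ℤ)
open import Data.Rational as ℚ using (ℚ; _⊓_)
open import Data.Bool using (Bool; true; false; not; _∧_; if_then_else_)
open import Data.Fin using (Fin)
open import Data.Vec as Vec using (Vec; []; _∷_; lookup; replicate; zipWith)
open import Data.Vec.Properties using (≡-dec)
open import Data.Vec.Relation.Unary.All as VAll using ()
open import Data.Nat.ListAction using (sum)
open import Data.List as List using (List; []; _∷_; length; filter; allFin)
open import Data.List.Relation.Unary.Any as Any using (Any; any?)
open import Data.List.Relation.Unary.All as All using (All)
open import Data.List.Relation.Unary.Unique.Propositional using (Unique)
open import Data.List.Membership.Propositional using (_∈_)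
open import Data.Sum using (_⊎_)
open import Data.Product using (_×_; ∃)
open import Function.Bundles using (_⇔_)
open import Relation.Nullary using (Dec; does; ¬_)
open import Relation.Nullary.Decidable using (_⊎-dec_)
open import Relation.Binary.PropositionalEquality using (_≡_)

Matrix : ℕ → ℕ → Set
Matrix m d = Vec (Vec ℤ d) m

ZVec : ℕ → Set
ZVec d = Vec ℤ d

NVec : ℕ → Set
NVec d = Vec ℕ d

toZ : ∀ {d} → NVec d → ZVec d
toZ = Vec.map (λ k → + k)

dot : ∀ {d} → ZVec d → ZVec d → ℤ
dot x y = Vec.foldr _ ℤ._+_ 0ℤ (zipWith ℤ._*_ x y)

_·_ : ∀ {m d} → Matrix m d → ZVec d → ZVec m
A · x = Vec.map (λ row → dot row x) A

_+ᵥ_ : ∀ {d} → ZVec d → ZVec d → ZVec d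
_+ᵥ_ = zipWith ℤ._+_

_-ᵥ_ : ∀ {d} → ZVec d → ZVec d → ZVec d
_-ᵥ_ = zipWith ℤ._-_

-ᵥ_ : ∀ {d} → ZVec d → ZVec d
-ᵥ_ = Vec.map (λ z → ℤ.- z)

PointedKernel : ∀ {m d} → Matrix m d → Set
PointedKernel {m} {d} A = ∀ (u : NVec d) → A · toZ u ≡ replicate m 0ℤ → u ≡ replicate d 0

InSemigroup : ∀ {m d} → Matrix m d → ZVec m → Set
InSemigroup {m} {d} A b = ∃ λ (u : NVec d) → A · toZ u ≡ b

-- L is a duplicate-free enumeration of the fiber F_{A,b} = {u ∈ ℕ^d : Au = b};
-- hence |F_{A,b}| = length L.
IsFiberEnum : ∀ {m d} → Matrix m d → ZVec m → List (NVec d) → Set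
IsFiberEnum {m} {d} A b L = Unique L × (∀ (u : NVec d) → (u ∈ L) ⇔ (A · toZ u ≡ b))

-- M is a finite subset of ker_ℤ(A), given as a duplicate-free list; |M| = length M.
IsKernelSet : ∀ {m d} → Matrix m d → List (ZVec d) → Set
IsKernelSet {m} {d} A M = Unique M × All (λ x → A · x ≡ replicate m 0ℤ) M

_≟ᵥ_ : ∀ {d} (x y : ZVec d) → Dec (x ≡ y)
_≟ᵥ_ = ≡-dec ℤ._≟_

InPM : ∀ {d} → List (ZVec d) → ZVec d → Set
InPM M x = Any (λ y → (x ≡ y) ⊎ (x ≡ -ᵥ y)) M

inPM? : ∀ {d} (M : List (ZVec d)) (x : ZVec d) → Dec (InPM M x)
inPM? M x = any? (λ y → (x ≟ᵥ y) ⊎-dec (x ≟ᵥ (-ᵥ y))) M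

Nonneg : ∀ {d} → ZVec d → Set
Nonneg = VAll.All (λ z → 0ℤ ℤ.≤ z)

nonneg? : ∀ {d} (x : ZVec d) → Dec (Nonneg x)
nonneg? = VAll.all? (λ z → 0ℤ ℤ.≤? z)

count : ∀ {a} {X : Set a} → (X → Bool) → List X → ℕ
count p xs = length (filter (λ x → Data.Bool.T? (p x)) xs)
  where import Data.Bool

Subset : ℕ → Set
Subset n = Vec Bool n

allSubsets : (n : ℕ) → List (Subset n)
allSubsets zero = [] ∷ []
allSubsets (suc n) = List.map (true ∷_) (allSubsets n) List.++ List.map (false ∷_) (allSubsets n)

card : ∀ {n} → Subset n → ℕ
card S = count (λ i → lookup S i) (allFin _)

-- |E_G(S)|: edges {i,j} with i ∈ S, j ∉ S (counted once, via the endpoint in S).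
-- Loops never contribute since both endpoints lie on the same side.
cutSize : ∀ {n} → (Fin n → Fin n → Bool) → Subset n → ℕ
cutSize {n} adj S =
  sum (List.map (λ i → count (λ j → lookup S i ∧ not (lookup S j) ∧ adj i j) (allFin n)) (allFin n))

-- e / k as a rational (k = 0 never occurs where used)
ratio : ℕ → ℕ → ℚ
ratio e zero = ℚ.0ℚ
ratio e (suc k) = (+ e) ℚ./ suc k

minList : List ℚ → ℚ
minList [] = ℚ.0ℚ
minList (x ∷ xs) = List.foldr _⊓_ x xs

edgeExpansion : ∀ {n} → (Fin n → Fin n → Bool) → ℚ
edgeExpansion {n} adj =
  minList (List.map (λ S → ratio (cutSize adj S) (card S))
    (filter (λ S → (0 <? card S) Relation.Nullary.Decidable.×-dec (2 * card S ≤? n)) (allSubsets n)))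
  where import Relation.Nullary.Decidable

-- Fiber graph F(M) on an enumerated fiber L: u,v adjacent iff u - v ∈ ±M.
-- (Loops play no role in edge-expansion.)

fiberAdj : ∀ {d} → (L : List (NVec d)) → List (ZVec d) → Fin (length L) → Fin (length L) → Bool
fiberAdj L M i j = does (inPM? M (toZ (List.lookup L i) -ᵥ toZ (List.lookup L j)))

fiberGraphExpansion : ∀ {d} → (L : List (NVec d)) → List (ZVec d) → ℚ
fiberGraphExpansion L M = edgeExpansion (fiberAdj L M)

-- |∂^M_u(F_{A,b})| where L enumerates F_{A,b}:
-- v ∈ u + F_{A,b} with some m ∈ ±M, v + m ∈ ℕ^d \ (u + F_{A,b}).

InShift : ∀ {d} → NVec d → List (NVec d) → ZVec d → Set
InShift u L v = Any (λ x → v ≡ toZ u +ᵥ toZ x) L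

inShift? : ∀ {d} (u : NVec d) (L : List (NVec d)) (v : ZVec d) → Dec (InShift u L v)
inShift? u L v = any? (λ x → v ≟ᵥ (toZ u +ᵥ toZ x)) L

IsBoundaryPoint : ∀ {d} → List (ZVec d) → NVec d → List (NVec d) → ZVec d → Set
IsBoundaryPoint M u L v =
  Any (λ y → (Nonneg (v +ᵥ y) × ¬ InShift u L (v +ᵥ y))
           ⊎ (Nonneg (v +ᵥ (-ᵥ y)) × ¬ InShift u L (v +ᵥ (-ᵥ y)))) M

isBoundaryPoint? : ∀ {d} (M : List (ZVec d)) (u : NVec d) (L : List (NVec d)) (v : ZVec d) →
                   Dec (IsBoundaryPoint M u L v)
isBoundaryPoint? M u L v = any? (λ y →
    (nonneg? (v +ᵥ y) ×-dec ¬? (inShift? u L (v +ᵥ y)))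
    ⊎-dec (nonneg? (v +ᵥ (-ᵥ y)) ×-dec ¬? (inShift? u L (v +ᵥ (-ᵥ y))))) M
  where open Relation.Nullary.Decidable using (_×-dec_; ¬?)
        import Relation.Nullary.Decidable

-- the elements of u + F_{A,b} are u + x for x in L (distinct since L is);
-- count those that are boundary points.
boundarySize : ∀ {d} → List (ZVec d) → NVec d → List (NVec d) → ℕ
boundarySize M u L = count (λ x → does (isBoundaryPoint? M u L (toZ u +ᵥ toZ x))) L

-- Let L enumerate F = F_{A,b'+b} and Lb enumerate F_{A,b}. Since
-- Au = b', the translate S = u + F_{A,b} is contained in F, and translation
-- is injective, so |S| = |F_{A,b}|. This is positive because b ∈ ℕA, and
-- 2|S| ≤ |F| by hypothesis, so S is admissible in the minimum defining h and
-- h ≤ |E(S)|/|S|. If v ∈ S, w ∉ S and v - w ∈ ±M, then w = v ∓ y ∈ ℕ^d for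
-- some y ∈ M while w ∉ u + F_{A,b}, so v is a boundary point; and v has at
-- most 2|M| neighbours (they lie among v ± y). Hence
-- |E(S)| ≤ 2|M|·|S ∩ ∂| ≤ 2|M|·|∂|.
module Submission where

open import Defs
open import Data.Nat as ℕ using (ℕ; zero; suc; _*_; _+_; _≤_; _<_; z≤n; s≤s)
import Data.Nat.Properties as ℕP
open import Data.Integer as ℤ using (+≤+)
import Data.Integer.Properties as ℤP
open import Data.Integer.Tactic.RingSolver using (solve-∀)
open import Data.Rational using (ℚ; _⊓_) renaming (_≤_ to _≤ℚ_)
import Data.Rational.Properties as ℚP
import Data.Rational.Unnormalised as ℚᵘ
import Data.Rational.Unnormalised.Properties as ℚᵘP
open import Data.Bool using (Bool; true; false; not; _∧_; T; if_then_else_)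
open import Data.Bool.Properties using (T-∧)
open import Data.Unit using (tt)
open import Data.Fin using (Fin)
open import Data.Vec as Vec using ([]; _∷_)
import Data.Vec.Properties as VP
import Data.Vec.Relation.Unary.All as VAll
open import Data.List as List using (List; []; _∷_; length; filter; allFin; map; _++_)
import Data.List.Properties as LP
open import Data.List.Relation.Unary.Any as Any using (here; there)
open import Data.List.Relation.Unary.AllPairs using (_∷_)
import Data.List.Relation.Unary.All as All
open import Data.List.Relation.Unary.Unique.Propositional using (Unique)
import Data.List.Relation.Unary.Unique.Propositional.Properties as Uniq
open import Data.List.Relation.Binary.Subset.Propositional using (_⊆_)
open import Data.List.Membership.Propositional using (_∈_; find; lose)
open import Data.List.Membership.Propositional.Properties
  using (∈-∃++; ∈-++⁻; ∈-++⁺ˡ; ∈-++⁺ʳ; ∈-map⁺; ∈-map⁻; ∈-filter⁺; ∈-filter⁻)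
open import Data.Nat.ListAction using (sum)
open import Data.Product using (_×_; _,_; proj₁; proj₂; ∃)
open import Data.Sum using (_⊎_; inj₁; inj₂)
open import Data.Empty using (⊥-elim)
open import Function using (_∘_)
open import Function.Bundles using (Equivalence)
open import Relation.Nullary using (Dec; does; yes; no; ¬_)
open import Relation.Nullary.Decidable using (T?)
open import Relation.Binary.PropositionalEquality

does⇒ : ∀ {p} {P : Set p} (P? : Dec P) → T (does P?) → P
does⇒ (yes p) _ = p

⇒does : ∀ {p} {P : Set p} (P? : Dec P) → P → T (does P?)
⇒does (yes _) _ = tt
⇒does (no ¬p) p = ¬p p

T-not⇒¬T : ∀ {b} → T (not b) → ¬ T b
T-not⇒¬T {true} () _

module _ {a} {X : Set a} where

  count-cong : {p q : X → Bool} → (∀ x → p x ≡ q x) → ∀ xs → count p xs ≡ count q xs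
  count-cong eq [] = refl
  count-cong {p} {q} eq (x ∷ xs) with p x | q x | eq x
  ... | true  | .true  | refl = cong suc (count-cong eq xs)
  ... | false | .false | refl = count-cong eq xs

  count-none : (p : X → Bool) → (∀ x → ¬ T (p x)) → ∀ xs → count p xs ≡ 0
  count-none p never xs = cong length (LP.filter-none (λ x → T? (p x)) (All.universal never xs))

  count-mono : {p q : X → Bool} → (∀ x → T (p x) → T (q x)) → ∀ xs → count p xs ≤ count q xs
  count-mono p⇒q [] = z≤n
  count-mono {p} {q} p⇒q (x ∷ xs) with p x in px | q x in qx
  ... | true  | true  = s≤s (count-mono p⇒q xs)
  ... | false | true  = ℕP.m≤n⇒m≤1+n (count-mono p⇒q xs)
  ... | false | false = count-mono p⇒q xs
  ... | true  | false = ⊥-elim (subst T qx (p⇒q x (subst T (sym px) tt)))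

  sum-≤-support : (c : ℕ) (f : X → ℕ) (p : X → Bool) →
                  (∀ x → f x ≤ (if p x then c else 0)) →
                  ∀ xs → sum (map f xs) ≤ c * count p xs
  sum-≤-support c f p bound [] = ℕP.≤-reflexive (sym (ℕP.*-zeroʳ c))
  sum-≤-support c f p bound (x ∷ xs) with p x | bound x
  ... | true  | fx≤c = ℕP.≤-trans (ℕP.+-mono-≤ fx≤c (sum-≤-support c f p bound xs))
                                  (ℕP.≤-reflexive (sym (ℕP.*-suc c _)))
  ... | false | fx≤0 = ℕP.+-mono-≤ fx≤0 (sum-≤-support c f p bound xs)

  unique-⊆-length : {xs ys : List X} → Unique xs → xs ⊆ ys → length xs ≤ length ys
  unique-⊆-length {[]} _ _ = z≤n
  unique-⊆-length {x ∷ xs} {ys} (x∉xs ∷ uniq) xs⊆ys with ∈-∃++ (xs⊆ys (here refl))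
  ... | (pre , post , refl) = begin
      suc (length xs)           ≤⟨ s≤s (unique-⊆-length uniq xs⊆pre++post) ⟩
      suc (length (pre ++ post)) ≡⟨ sym (LP.length-++-sucʳ pre x post) ⟩
      length (pre ++ x ∷ post)   ∎
    where
    open ℕP.≤-Reasoning
    xs⊆pre++post : xs ⊆ pre ++ post
    xs⊆pre++post {z} z∈xs with ∈-++⁻ pre (xs⊆ys (there z∈xs))
    ... | inj₁ z∈pre         = ∈-++⁺ˡ z∈pre
    ... | inj₂ (here refl)   = ⊥-elim (All.lookup x∉xs z∈xs refl)
    ... | inj₂ (there z∈post) = ∈-++⁺ʳ pre z∈post

  unique-≈-length : {xs ys : List X} → Unique xs → Unique ys → xs ⊆ ys → ys ⊆ xs →
                    length xs ≡ length ys
  unique-≈-length ux uy xs⊆ys ys⊆xs =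
    ℕP.≤-antisym (unique-⊆-length ux xs⊆ys) (unique-⊆-length uy ys⊆xs)

  ∈⇒0<length : {x : X} {xs : List X} → x ∈ xs → 0 < length xs
  ∈⇒0<length (here _)  = s≤s z≤n
  ∈⇒0<length (there _) = s≤s z≤n

  map-lookup-allFin : (L : List X) → map (List.lookup L) (allFin (length L)) ≡ L
  map-lookup-allFin L = trans (LP.map-tabulate (λ i → i) (List.lookup L)) (LP.tabulate-lookup L)

  count-map : ∀ {b} {Y : Set b} (p : X → Bool) (f : Y → X) (ys : List Y) →
              count p (map f ys) ≡ count (p ∘ f) ys
  count-map p f [] = refl
  count-map p f (y ∷ ys) with p (f y)
  ... | true  = cong suc (count-map p f ys)
  ... | false = count-map p f ys

  count-positions : (p : X → Bool) (L : List X) →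
                    count (p ∘ List.lookup L) (allFin (length L)) ≡ count p L
  count-positions p L = trans (sym (count-map p (List.lookup L) (allFin (length L))))
                              (cong (count p) (map-lookup-allFin L))

  sum-positions : (f : X → ℕ) (L : List X) →
                  sum (map (f ∘ List.lookup L) (allFin (length L))) ≡ sum (map f L)
  sum-positions f L = trans (cong sum (LP.map-∘ (allFin (length L))))
                            (cong (sum ∘ map f) (map-lookup-allFin L))

-- The ratio e/k is monotone in e (for k = 0 both sides are 0 by convention).
ratio-mono : ∀ {e e′} k → e ≤ e′ → ratio e k ≤ℚ ratio e′ k
ratio-mono zero _ = ℚP.≤-refl
ratio-mono {e} {e′} (suc k) e≤e′ = ℚP.toℚᵘ-cancel-≤
  (ℚᵘP.≤-respˡ-≃ (ℚᵘP.≃-sym (ℚP.toℚᵘ-fromℚᵘ (ℚᵘ.mkℚᵘ (ℤ.+ e) k)))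
  (ℚᵘP.≤-respʳ-≃ (ℚᵘP.≃-sym (ℚP.toℚᵘ-fromℚᵘ (ℚᵘ.mkℚᵘ (ℤ.+ e′) k)))
  (ℚᵘ.*≤* (ℤP.*-monoʳ-≤-nonNeg (ℤ.+ suc k) (+≤+ e≤e′)))))

foldr-⊓-≤-init : ∀ x zs → List.foldr _⊓_ x zs ≤ℚ x
foldr-⊓-≤-init x []       = ℚP.≤-refl
foldr-⊓-≤-init x (z ∷ zs) = ℚP.≤-trans (ℚP.p⊓q≤q z _) (foldr-⊓-≤-init x zs)

foldr-⊓-≤-∈ : ∀ x zs {z} → z ∈ zs → List.foldr _⊓_ x zs ≤ℚ z
foldr-⊓-≤-∈ x (z ∷ zs) (here refl) = ℚP.p⊓q≤p z _
foldr-⊓-≤-∈ x (z ∷ zs) (there z∈) = ℚP.≤-trans (ℚP.p⊓q≤q z _) (foldr-⊓-≤-∈ x zs z∈)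

minList-≤ : ∀ {a} {Y : Set a} (g : Y → ℚ) {ys : List Y} {y : Y} → y ∈ ys → minList (map g ys) ≤ℚ g y
minList-≤ g {y₀ ∷ ys} (here refl) = foldr-⊓-≤-init (g y₀) (map g ys)
minList-≤ g {y₀ ∷ ys} (there y∈) = foldr-⊓-≤-∈ (g y₀) (map g ys) (∈-map⁺ g y∈)

∈-allSubsets : ∀ {n} (S : Subset n) → S ∈ allSubsets n
∈-allSubsets [] = here refl
∈-allSubsets {suc n} (true ∷ S) = ∈-++⁺ˡ (∈-map⁺ (true ∷_) (∈-allSubsets S))
∈-allSubsets {suc n} (false ∷ S) =
  ∈-++⁺ʳ (map (true ∷_) (allSubsets n)) (∈-map⁺ (false ∷_) (∈-allSubsets S))

edgeExpansion-≤ : ∀ {n} (adj : Fin n → Fin n → Bool) (S : Subset n) →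
                  0 < card S → 2 * card S ≤ n → edgeExpansion adj ≤ℚ ratio (cutSize adj S) (card S)
edgeExpansion-≤ adj S 0<|S| 2|S|≤n =
  minList-≤ (λ S → ratio (cutSize adj S) (card S)) (∈-filter⁺ _ (∈-allSubsets S) (0<|S| , 2|S|≤n))

_⊕_ : ∀ {d} → NVec d → NVec d → NVec d
_⊕_ = Vec.zipWith ℕ._+_

toZ-injective : ∀ {d} {x y : NVec d} → toZ x ≡ toZ y → x ≡ y
toZ-injective {x = []}    {[]}    _ = refl
toZ-injective {x = a ∷ x} {b ∷ y} e =
  cong₂ _∷_ (ℤP.+-injective (VP.∷-injectiveˡ e)) (toZ-injective (VP.∷-injectiveʳ e))

toZ-⊕ : ∀ {d} (u x : NVec d) → toZ (u ⊕ x) ≡ toZ u +ᵥ toZ x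
toZ-⊕ []      []      = refl
toZ-⊕ (a ∷ u) (b ∷ x) = cong (_ ∷_) (toZ-⊕ u x)

⊕-cancelˡ : ∀ {d} (u : NVec d) {x y : NVec d} → u ⊕ x ≡ u ⊕ y → x ≡ y
⊕-cancelˡ []      {[]}    {[]}    _ = refl
⊕-cancelˡ (a ∷ u) {b ∷ x} {c ∷ y} e =
  cong₂ _∷_ (ℕP.+-cancelˡ-≡ a b c (VP.∷-injectiveˡ e)) (⊕-cancelˡ u (VP.∷-injectiveʳ e))

toZ-nonneg : ∀ {d} (v : NVec d) → Nonneg (toZ v)
toZ-nonneg []      = VAll.[]
toZ-nonneg (a ∷ v) = +≤+ z≤n VAll.∷ toZ-nonneg v

sub≡⇒≡add-neg : ∀ {d} (v w y : ZVec d) → v -ᵥ w ≡ y → w ≡ v +ᵥ (-ᵥ y)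
sub≡⇒≡add-neg []      []      []      _ = refl
sub≡⇒≡add-neg (a ∷ v) (c ∷ w) (e ∷ y) eq = cong₂ _∷_
  (trans (identity a c) (cong (λ t → a ℤ.+ ℤ.- t) (VP.∷-injectiveˡ eq)))
  (sub≡⇒≡add-neg v w y (VP.∷-injectiveʳ eq))
  where
  identity : ∀ a c → c ≡ a ℤ.+ ℤ.- (a ℤ.- c)
  identity = solve-∀

sub≡neg⇒≡add : ∀ {d} (v w y : ZVec d) → v -ᵥ w ≡ -ᵥ y → w ≡ v +ᵥ y
sub≡neg⇒≡add v w y eq = trans (sub≡⇒≡add-neg v w (-ᵥ y) eq) (cong (v +ᵥ_) (neg-involutive y))
  where
  neg-involutive : ∀ {d} (y : ZVec d) → -ᵥ (-ᵥ y) ≡ y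
  neg-involutive []      = refl
  neg-involutive (e ∷ y) = cong₂ _∷_ (ℤP.neg-involutive e) (neg-involutive y)

dot-+ : ∀ {d} (r x y : ZVec d) → dot r (x +ᵥ y) ≡ dot r x ℤ.+ dot r y
dot-+ []       []       []       = refl
dot-+ (r ∷ rs) (x ∷ xs) (y ∷ ys) =
  trans (cong (λ t → r ℤ.* (x ℤ.+ y) ℤ.+ t) (dot-+ rs xs ys)) (distribute r x y (dot rs xs) (dot rs ys))
  where
  distribute : ∀ r x y p q → r ℤ.* (x ℤ.+ y) ℤ.+ (p ℤ.+ q) ≡ (r ℤ.* x ℤ.+ p) ℤ.+ (r ℤ.* y ℤ.+ q)
  distribute = solve-∀

·-+ : ∀ {m d} (A : Matrix m d) (x y : ZVec d) → A · (x +ᵥ y) ≡ (A · x) +ᵥ (A · y)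
·-+ []      x y = refl
·-+ (r ∷ A) x y = cong₂ _∷_ (dot-+ r x y) (·-+ A x y)

-- Fix A, enumerations Lb of F_{A,b} and L of F_{A,b'+b}, the move set M and
-- u with Au = b'. The vertex set S of the argument is u + F_{A,b} inside L.
module Translate {m d : ℕ} (A : Matrix m d) (b b′ : ZVec m) (Lb L : List (NVec d))
  (M : List (ZVec d)) (u : NVec d)
  (fiberLb : IsFiberEnum A b Lb) (fiberL : IsFiberEnum A (b′ +ᵥ b) L)
  (Au≡b′ : A · toZ u ≡ b′) where

  inS : NVec d → Bool
  inS v = does (inShift? u Lb (toZ v))

  adjacent : NVec d → NVec d → Bool
  adjacent v w = does (inPM? M (toZ v -ᵥ toZ w))

  onBoundary : NVec d → Bool
  onBoundary v = does (isBoundaryPoint? M u Lb (toZ v))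

  crosses : NVec d → NVec d → Bool
  crosses v w = inS v ∧ not (inS w) ∧ adjacent v w

  inS∂ : NVec d → Bool
  inS∂ v = inS v ∧ onBoundary v

  inS⇒translate : ∀ {v} → T (inS v) → ∃ λ x → x ∈ Lb × v ≡ u ⊕ x
  inS⇒translate {v} t with find (does⇒ (inShift? u Lb (toZ v)) t)
  ... | x , x∈Lb , eq = x , x∈Lb , toZ-injective (trans eq (sym (toZ-⊕ u x)))

  translate-inS : ∀ {x} → x ∈ Lb → T (inS (u ⊕ x))
  translate-inS {x} x∈Lb = ⇒does (inShift? u Lb (toZ (u ⊕ x))) (lose x∈Lb (toZ-⊕ u x))

  translate-∈L : ∀ {x} → x ∈ Lb → u ⊕ x ∈ L
  translate-∈L {x} x∈Lb = Equivalence.from (proj₂ fiberL (u ⊕ x)) (begin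
    A · toZ (u ⊕ x)           ≡⟨ cong (A ·_) (toZ-⊕ u x) ⟩
    A · (toZ u +ᵥ toZ x)      ≡⟨ ·-+ A (toZ u) (toZ x) ⟩
    (A · toZ u) +ᵥ (A · toZ x) ≡⟨ cong₂ _+ᵥ_ Au≡b′ (Equivalence.to (proj₂ fiberLb x) x∈Lb) ⟩
    b′ +ᵥ b                   ∎)
    where open ≡-Reasoning

  -- |S| = |F_{A,b}|: the members of L in S are exactly the translates u + x.
  count-inS : count inS L ≡ length Lb
  count-inS = trans
    (unique-≈-length (Uniq.filter⁺ (T? ∘ inS) (proj₁ fiberL)) (Uniq.map⁺ (⊕-cancelˡ u) (proj₁ fiberLb))
                     S⊆translates translates⊆S)
    (LP.length-map (u ⊕_) Lb)
    where
    S⊆translates : filter (T? ∘ inS) L ⊆ map (u ⊕_) Lb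
    S⊆translates v∈ with inS⇒translate (proj₂ (∈-filter⁻ (T? ∘ inS) {xs = L} v∈))
    ... | x , x∈Lb , refl = ∈-map⁺ (u ⊕_) x∈Lb
    translates⊆S : map (u ⊕_) Lb ⊆ filter (T? ∘ inS) L
    translates⊆S v∈ with ∈-map⁻ (u ⊕_) v∈
    ... | x , x∈Lb , refl = ∈-filter⁺ (T? ∘ inS) (translate-∈L x∈Lb) (translate-inS x∈Lb)

  -- |S ∩ ∂| ≤ |∂^M_u(F_{A,b})|: each such v is a translate u + x of a counted x.
  count-boundary : count inS∂ L ≤ boundarySize M u Lb
  count-boundary = ℕP.≤-trans
    (unique-⊆-length (Uniq.filter⁺ (T? ∘ inS∂) (proj₁ fiberL)) S∂⊆translates)
    (ℕP.≤-reflexive (LP.length-map (u ⊕_) boundaryLb))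
    where
    boundaryLb : List (NVec d)
    boundaryLb = filter (λ x → T? (does (isBoundaryPoint? M u Lb (toZ u +ᵥ toZ x)))) Lb
    S∂⊆translates : filter (T? ∘ inS∂) L ⊆ map (u ⊕_) boundaryLb
    S∂⊆translates {v} v∈ with proj₂ (∈-filter⁻ (T? ∘ inS∂) {xs = L} v∈)
    ... | v∈S∂ with Equivalence.to (T-∧ {inS v}) v∈S∂
    ... | v∈S , v∈∂ with inS⇒translate v∈S
    ... | x , x∈Lb , refl = ∈-map⁺ (u ⊕_) (∈-filter⁺ _ x∈Lb
          (⇒does (isBoundaryPoint? M u Lb _)
            (subst (IsBoundaryPoint M u Lb) (toZ-⊕ u x) (does⇒ (isBoundaryPoint? M u Lb _) v∈∂))))

  -- Every vertex has at most 2|M| neighbours: they lie among the v ± y, y ∈ M.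
  degree-≤ : ∀ v → count (adjacent v) L ≤ 2 * length M
  degree-≤ v = begin
    count (adjacent v) L               ≡⟨ sym (LP.length-map toZ N) ⟩
    length (map toZ N)                 ≤⟨ unique-⊆-length (Uniq.map⁺ toZ-injective
                                            (Uniq.filter⁺ (T? ∘ adjacent v) (proj₁ fiberL))) N⊆candidates ⟩
    length (plus ++ minus)             ≡⟨ LP.length-++ plus ⟩
    length plus + length minus         ≡⟨ cong₂ _+_ (LP.length-map _ M) (LP.length-map _ M) ⟩
    length M + length M                ≡⟨ cong (length M +_) (sym (ℕP.+-identityʳ (length M))) ⟩
    2 * length M                       ∎
    where
    open ℕP.≤-Reasoning
    N = filter (T? ∘ adjacent v) L
    plus  = map (λ y → toZ v +ᵥ y) M
    minus = map (λ y → toZ v +ᵥ (-ᵥ y)) M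
    N⊆candidates : map toZ N ⊆ plus ++ minus
    N⊆candidates z∈ with ∈-map⁻ toZ z∈
    ... | w , w∈N , refl with find (does⇒ (inPM? M _) (proj₂ (∈-filter⁻ (T? ∘ adjacent v) {xs = L} w∈N)))
    ... | y , y∈M , inj₁ v-w≡y =
      ∈-++⁺ʳ plus (subst (_∈ minus) (sym (sub≡⇒≡add-neg _ _ _ v-w≡y)) (∈-map⁺ _ y∈M))
    ... | y , y∈M , inj₂ v-w≡-y =
      ∈-++⁺ˡ (subst (_∈ plus) (sym (sub≡neg⇒≡add _ _ _ v-w≡-y)) (∈-map⁺ _ y∈M))

  -- A neighbour w ∉ S of v witnesses that v is a boundary point: w = v ∓ y
  -- lies in ℕ^d but not in u + F_{A,b}.
  crossing⇒boundary : ∀ v w → T (not (inS w)) → T (adjacent v w) → T (onBoundary v)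
  crossing⇒boundary v w w∉S v~w =
    ⇒does (isBoundaryPoint? M u Lb (toZ v)) (Any.map witness (does⇒ (inPM? M _) v~w))
    where
    w∉shift : ¬ InShift u Lb (toZ w)
    w∉shift w∈ = T-not⇒¬T w∉S (⇒does (inShift? u Lb (toZ w)) w∈)
    outside : ∀ {z} → toZ w ≡ z → Nonneg z × ¬ InShift u Lb z
    outside refl = toZ-nonneg w , w∉shift
    witness : ∀ {y} → (toZ v -ᵥ toZ w ≡ y) ⊎ (toZ v -ᵥ toZ w ≡ -ᵥ y) →
              (Nonneg (toZ v +ᵥ y) × ¬ InShift u Lb (toZ v +ᵥ y))
              ⊎ (Nonneg (toZ v +ᵥ (-ᵥ y)) × ¬ InShift u Lb (toZ v +ᵥ (-ᵥ y)))
    witness (inj₁ v-w≡y)  = inj₂ (outside (sub≡⇒≡add-neg _ _ _ v-w≡y))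
    witness (inj₂ v-w≡-y) = inj₁ (outside (sub≡neg⇒≡add _ _ _ v-w≡-y))

  crossings-at : ∀ v → count (crosses v) L ≤ (if inS∂ v then 2 * length M else 0)
  crossings-at v with inS v
  ... | false = ℕP.≤-reflexive (count-none _ (λ _ ()) L)
  ... | true with onBoundary v in v∂
  ...   | true  = ℕP.≤-trans (count-mono (λ w → proj₂ ∘ Equivalence.to T-∧) L) (degree-≤ v)
  ...   | false = ℕP.≤-reflexive (count-none _ no-crossing L)
    where
    no-crossing : ∀ w → ¬ T (true ∧ not (inS w) ∧ adjacent v w)
    no-crossing w c with Equivalence.to T-∧ c
    ... | w∉S , v~w = subst T v∂ (crossing⇒boundary v w w∉S v~w)

  S : Subset (length L)
  S = Vec.tabulate (inS ∘ List.lookup L)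

  lookup-S : ∀ i → Vec.lookup S i ≡ inS (List.lookup L i)
  lookup-S = VP.lookup∘tabulate (inS ∘ List.lookup L)

  card-S : card S ≡ length Lb
  card-S = trans (count-cong lookup-S (allFin (length L)))
                 (trans (count-positions inS L) count-inS)

  cut-≤ : cutSize (fiberAdj L M) S ≤ 2 * length M * boundarySize M u Lb
  cut-≤ = begin
    cutSize (fiberAdj L M) S                  ≡⟨ cutSize-as-crossings ⟩
    sum (map (λ v → count (crosses v) L) L)   ≤⟨ sum-≤-support _ _ inS∂ crossings-at L ⟩
    2 * length M * count inS∂ L               ≤⟨ ℕP.*-monoʳ-≤ (2 * length M) count-boundary ⟩
    2 * length M * boundarySize M u Lb        ∎
    where
    open ℕP.≤-Reasoning
    at : Fin (length L) → NVec d
    at = List.lookup L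
    crosses-at : ∀ i j → (Vec.lookup S i ∧ not (Vec.lookup S j) ∧ fiberAdj L M i j) ≡ crosses (at i) (at j)
    crosses-at i j rewrite lookup-S i | lookup-S j = refl
    cutSize-as-crossings : cutSize (fiberAdj L M) S ≡ sum (map (λ v → count (crosses v) L) L)
    cutSize-as-crossings = trans
      (cong sum (LP.map-cong (λ i → trans (count-cong (crosses-at i) (allFin (length L)))
                                          (count-positions (crosses (at i)) L)) (allFin (length L))))
      (sum-positions (λ v → count (crosses v) L) L)

lemma3p11 : ∀ {m d : ℕ} (A : Matrix m d) → PointedKernel A →
    (b b′ : ZVec m) → InSemigroup A b → InSemigroup A b′ →
    (Lb Lb′ Lb′b : List (NVec d)) →
    IsFiberEnum A b Lb → IsFiberEnum A b′ Lb′ → IsFiberEnum A (b′ +ᵥ b) Lb′b →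
    2 * length Lb ≤ length Lb′b →
    (M : List (ZVec d)) → IsKernelSet A M →
    (u : NVec d) → A · toZ u ≡ b′ →
    fiberGraphExpansion Lb′b M ≤ℚ ratio (2 * length M * boundarySize M u Lb) (length Lb)
lemma3p11 A _ b b′ (w , Aw≡b) _ Lb _ L fiberLb _ fiberL 2|Fb|≤|F| M _ u Au≡b′ = begin
  fiberGraphExpansion L M                         ≤⟨ edgeExpansion-≤ (fiberAdj L M) S 0<|S| 2|S|≤|F| ⟩
  ratio (cutSize (fiberAdj L M) S) (card S)       ≡⟨ cong (ratio _) card-S ⟩
  ratio (cutSize (fiberAdj L M) S) (length Lb)    ≤⟨ ratio-mono (length Lb) cut-≤ ⟩
  ratio (2 * length M * boundarySize M u Lb) (length Lb) ∎
  where
  open ℚP.≤-Reasoning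
  open Translate A b b′ Lb L M u fiberLb fiberL Au≡b′
  -- F_{A,b} is nonempty because b ∈ ℕA.
  0<|S| : 0 < card S
  0<|S| = subst (0 <_) (sym card-S) (∈⇒0<length (Equivalence.from (proj₂ fiberLb w) Aw≡b))
  2|S|≤|F| : 2 * card S ≤ length L
  2|S|≤|F| = subst (λ k → 2 * k ≤ length L) (sym card-S) 2|Fb|≤|F|
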